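{- For all $n\ge 9$, the maximum possible value of $\mathrm{peri}(T)$ among all trees $T$ of order $n$ is $\binom{n}{2}$.
   Context: For a graph $G$ and distinct vertices $u,v$, let $n_G(u,v)$ be the number of vertices strictly closer to $u$ than to $v$. The peripherality $\mathrm{peri}(v)$ of a vertex $v$ is the number of vertices $u\in V(G)$ with $n_G(u,v)>n_G(v,u)$, and $\mathrm{peri}(G)=\sum_{v\in V(G)}\mathrm{peri}(v)$. -}

module Defs where

open import Data.Bool using (Bool; true; false; _∧_; _∨_; not; if_then_else_)
open import Data.Nat using (ℕ; zero; suc; _<ᵇ_; _≤_)
open import Data.Fin using (Fin; _≟_)
open import Data.List using (List; []; _∷_; _++_; length; filter; allFin; upTo; map)
open import Data.Bool.ListAction using (any)
open import Data.Nat.ListAction using (sum)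
open import Data.List.Relation.Unary.Unique.Propositional using (Unique)
open import Data.List.Relation.Unary.Linked using (Linked)
open import Relation.Binary.PropositionalEquality using (_≡_)
open import Relation.Nullary using (¬_)
open import Relation.Nullary.Decidable using (⌊_⌋)
open import Data.Product using (Σ; _×_)

record Graph (n : ℕ) : Set where
  field
    adj     : Fin n → Fin n → Bool
    adj-sym : ∀ u v → adj u v ≡ adj v u
    irrefl  : ∀ u → adj u u ≡ false
open Graph public

count : ∀ {n} → (Fin n → Bool) → ℕ
count {n} p = length (filter (λ x → p x ≡? true) (allFin n))
  where
  open import Data.Bool.Properties using () renaming (_≟_ to _≡?_)

module _ {n : ℕ} (G : Graph n) where

  within : ℕ → Fin n → Fin n → Bool
  within zero    u v = ⌊ u ≟ v ⌋
  within (suc k) u v = within k u v ∨ any (λ w → within k u w ∧ adj G w v) (allFin n)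

  -- Connected: every two vertices are joined by a walk (a walk of length ≤ n suffices).
  Connected : Set
  Connected = ∀ u v → within n u v ≡ true

  -- A cycle: distinct vertices x, y₁, …, y_k (k ≥ 2, so at least 3 vertices),
  -- consecutive ones adjacent, and the last adjacent to x.
  record Cycle : Set where
    field
      start    : Fin n
      rest     : List (Fin n)
      long     : 2 ≤ length rest
      distinct : Unique (start ∷ rest)
      closed   : Linked (λ a b → adj G a b ≡ true) (start ∷ rest ++ start ∷ [])

  Acyclic : Set
  Acyclic = ¬ Cycle

  IsTree : Set
  IsTree = Connected × Acyclic

  -- Graph distance d(u,v) = least k with a walk of length ≤ k from u to v
  -- (since `within k u v` is monotone in k, this is the number of k < n
  -- with no such walk; for connected graphs this is the usual distance).
  dist : Fin n → Fin n → ℕ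
  dist u v = length (filter (λ k → not (within k u v) ≡? true) (upTo n))
    where
    open import Data.Bool.Properties using () renaming (_≟_ to _≡?_)

  nG : Fin n → Fin n → ℕ
  nG u v = count (λ w → dist w u <ᵇ dist w v)

  peri : Fin n → ℕ
  peri v = count (λ u → nG v u <ᵇ nG u v)

  periG : ℕ
  periG = sum (map peri (allFin n))

-- peri(G) counts the ordered pairs (v, u) with n(u,v) > n(v,u), so each pair of distinct
-- vertices contributes 1 if n(u,v) ≠ n(v,u) and 0 otherwise: peri(G) ≤ C(n,2), with equality
-- iff no two distinct vertices tie.
-- For n ≥ 9 a tree without ties is the spider made of a path 0, 1, …, m - 1 with m = 2c + 2
-- and a leg of a ∈ {1, 2} vertices hanging at c, where n = 2c + 2 + a and c ≥ 3. In most
-- comparisons a path vertex t prefers one of the two compared vertices according as α + 2t is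
-- below or above some S, and the numbers A, B of such t satisfy A + α + m = B + S + 1, while
-- the leg, which sees the path only through c, takes one side as a whole; this never balances.
-- In the other comparisons (a leg vertex against a path vertex close to c, or two leg
-- vertices) at most a vertices prefer one side and at least c > a the other.

module Submission where

open import Defs
open import Data.Bool using (Bool; true; false; T; not)
open import Data.Bool.Properties using (T-∨; T-∧; T-≡) renaming (_≟_ to _≟ᵇ_)
open import Data.Empty using (⊥; ⊥-elim)
open import Data.Fin as Fin using (Fin; toℕ; splitAt; join; fromℕ<)
open import Data.Fin.Properties using (toℕ<n; toℕ-injective; join-splitAt; splitAt-join; toℕ-fromℕ<)
import Data.Fin.Properties as Finₚ
open import Data.List using (List; []; _∷_; _++_; map; allFin; tabulate; applyUpTo; length; filter)
open import Data.List.Membership.Propositional using (_∈_; lose)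
open import Data.List.Membership.Propositional.Properties using (∈-allFin; ∈-++⁺ʳ)
open import Data.List.Relation.Unary.All as All using (All; _∷_)
open import Data.List.Relation.Unary.AllPairs using (AllPairs; _∷_)
open import Data.List.Relation.Unary.Any using (here; there; satisfied)
open import Data.List.Relation.Unary.Any.Properties using (any⁺; any⁻)
open import Data.List.Relation.Unary.Linked as Linked using (Linked; _∷_; [-])
open import Data.List.Relation.Unary.Linked.Properties using (Linked⇒All)
open import Data.Nat using (ℕ; zero; suc; _+_; _*_; _∸_; _≤_; _<_; _<ᵇ_; _≡ᵇ_; ∣_-_∣; _⊔_; z≤n; s≤s)
open import Data.Nat.Combinatorics using (_C_; nC1≡n; nCk+nC[k+1]≡[n+1]C[k+1])
open import Data.Nat.DivMod using (_/_; _%_; m≡m%n+[m/n]*n; m%n<n; /-monoˡ-≤)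
open import Data.Nat.ListAction using () renaming (sum to sumˡ)
open import Data.Nat.Properties
open import Data.Nat.Tactic.RingSolver using (solve-∀)
open import Data.Product using (Σ; _×_; _,_; proj₁; proj₂; swap; ∃-syntax)
open import Data.Sum using (_⊎_; inj₁; inj₂; [_,_]′) renaming (map₁ to ⊎-map₁)
open import Data.Unit using (⊤; tt)
open import Function using (_∘_; Equivalence)
open import Relation.Binary.Definitions using (Tri; tri<; tri≈; tri>)
open import Relation.Binary.PropositionalEquality using (_≡_; _≢_; refl; sym; trans; cong; cong₂; subst; subst₂; module ≡-Reasoning)
open import Relation.Nullary using (¬_; contradiction; yes; no)
open import Relation.Nullary.Decidable using (toWitness; fromWitness)

open import Algebra.Properties.CommutativeMonoid.Sum +-0-commutativeMonoid using (sum-syntax; ∑-distrib-+; sum-cong-≗)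
open import Algebra.Properties.CommutativeSemigroup +-commutativeSemigroup using (interchange; x∙yz≈xz∙y; xy∙z≈xz∙y)

fromBool : Bool → ℕ
fromBool false = 0
fromBool true  = 1

fromBool≤1 : ∀ b → fromBool b ≤ 1
fromBool≤1 false = z≤n
fromBool≤1 true  = s≤s z≤n

fromBool-mono : ∀ {a b} → (T a → T b) → fromBool a ≤ fromBool b
fromBool-mono {false}         _   = z≤n
fromBool-mono {true}  {true}  _   = s≤s z≤n
fromBool-mono {true}  {false} a⇒b = ⊥-elim (a⇒b tt)

fromBool-false : ∀ {b} → ¬ T b → fromBool b ≡ 0
fromBool-false {false} _ = refl
fromBool-false {true}  ¬T = ⊥-elim (¬T tt)

T-ext : ∀ {a b} → (T a → T b) → (T b → T a) → a ≡ b
T-ext {false} {false} _   _   = refl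
T-ext {false} {true}  _   b⇒a = contradiction (b⇒a tt) λ ()
T-ext {true}  {false} a⇒b _   = contradiction (a⇒b tt) λ ()
T-ext {true}  {true}  _   _   = refl

T-not : ∀ {b} → ¬ T b → T (not b)
T-not {false} _  = tt
T-not {true}  ¬T = ¬T tt

T-not⁻ : ∀ {b} → T (not b) → ¬ T b
T-not⁻ {false} _ ()

<ᵇ-cong : ∀ {a b c d} → (a < b → c < d) → (c < d → a < b) → (a <ᵇ b) ≡ (c <ᵇ d)
<ᵇ-cong {a} {b} {c} {d} ⇒ ⇐ = T-ext (<⇒<ᵇ ∘ ⇒ ∘ <ᵇ⇒< a b) (<⇒<ᵇ ∘ ⇐ ∘ <ᵇ⇒< c d)

<ᵇ-true : ∀ {a b} → a < b → (a <ᵇ b) ≡ true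
<ᵇ-true a<b = T-ext (λ _ → tt) (λ _ → <⇒<ᵇ a<b)

<ᵇ-false : ∀ {a b} → b ≤ a → (a <ᵇ b) ≡ false
<ᵇ-false {a} {b} b≤a = T-ext (λ a<b → <⇒≱ (<ᵇ⇒< a b a<b) b≤a) λ ()

<ᵇ-asym : ∀ a b → T (a <ᵇ b) → ¬ T (b <ᵇ a)
<ᵇ-asym a b a<b b<a = <-asym (<ᵇ⇒< a b a<b) (<ᵇ⇒< b a b<a)

<ᵇ-connex : ∀ {a b} → a ≢ b → T (a <ᵇ b) ⊎ T (b <ᵇ a)
<ᵇ-connex {a} {b} a≢b with <-cmp a b
... | tri< a<b _ _ = inj₁ (<⇒<ᵇ a<b)
... | tri≈ _ a≡b _ = contradiction a≡b a≢b
... | tri> _ _ b<a = inj₂ (<⇒<ᵇ b<a)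

+-<ᵇ-cancelˡ : ∀ α x y → (α + x <ᵇ α + y) ≡ (x <ᵇ y)
+-<ᵇ-cancelˡ zero    x y = refl
+-<ᵇ-cancelˡ (suc α) x y = +-<ᵇ-cancelˡ α x y

length-filter-tabulate : ∀ {A : Set} {n} (p : A → Bool) (f : Fin n → A) →
  length (filter (λ x → p x ≟ᵇ true) (tabulate f)) ≡ ∑[ i < n ] fromBool (p (f i))
length-filter-tabulate {n = zero}  p f = refl
length-filter-tabulate {n = suc n} p f with p (f Fin.zero)
... | true  = cong suc (length-filter-tabulate p (f ∘ Fin.suc))
... | false = length-filter-tabulate p (f ∘ Fin.suc)

count≡∑ : ∀ {n} (p : Fin n → Bool) → count p ≡ ∑[ i < n ] fromBool (p i)
count≡∑ p = length-filter-tabulate p (λ i → i)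

sumˡ-map-tabulate : ∀ {A : Set} {n} (g : A → ℕ) (f : Fin n → A) →
  sumˡ (map g (tabulate f)) ≡ ∑[ i < n ] g (f i)
sumˡ-map-tabulate {n = zero}  g f = refl
sumˡ-map-tabulate {n = suc n} g f = cong (g (f Fin.zero) +_) (sumˡ-map-tabulate g (f ∘ Fin.suc))

applyUpTo≡tabulate : ∀ {A : Set} (f : ℕ → A) n → applyUpTo f n ≡ tabulate {n = n} (f ∘ toℕ)
applyUpTo≡tabulate f zero    = refl
applyUpTo≡tabulate f (suc n) = cong (f 0 ∷_) (applyUpTo≡tabulate (f ∘ suc) n)

∑-mono-≤ : ∀ n {f g : Fin n → ℕ} → (∀ i → f i ≤ g i) → ∑[ i < n ] f i ≤ ∑[ i < n ] g i
∑-mono-≤ zero    f≤g = z≤n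
∑-mono-≤ (suc n) f≤g = +-mono-≤ (f≤g Fin.zero) (∑-mono-≤ n (f≤g ∘ Fin.suc))

∑-splitAt : ∀ m {a} (g : Fin m ⊎ Fin a → ℕ) →
  ∑[ x < m + a ] g (splitAt m x) ≡ ∑[ i < m ] g (inj₁ i) + ∑[ d < a ] g (inj₂ d)
∑-splitAt zero    g = refl
∑-splitAt (suc m) g = trans (cong (g (inj₁ Fin.zero) +_) (∑-splitAt m (g ∘ ⊎-map₁ Fin.suc)))
                           (sym (+-assoc (g (inj₁ Fin.zero)) _ _))

countBelow : ℕ → (ℕ → Bool) → ℕ
countBelow m p = ∑[ t < m ] fromBool (p (toℕ t))

countBelow-cong : ∀ m {p q : ℕ → Bool} → (∀ t → p t ≡ q t) → countBelow m p ≡ countBelow m q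
countBelow-cong m p≗q = sum-cong-≗ {m} (λ t → cong fromBool (p≗q (toℕ t)))

countBelow-mono : ∀ m {p q : ℕ → Bool} → (∀ t → T (p t) → T (q t)) → countBelow m p ≤ countBelow m q
countBelow-mono zero    p⇒q = z≤n
countBelow-mono (suc m) p⇒q = +-mono-≤ (fromBool-mono (p⇒q 0)) (countBelow-mono m (p⇒q ∘ suc))

countBelow≤ : ∀ m p → countBelow m p ≤ m
countBelow≤ zero    p = z≤n
countBelow≤ (suc m) p = +-mono-≤ (fromBool≤1 (p 0)) (countBelow≤ m (p ∘ suc))

countBelow-all : ∀ m {p} → (∀ t → T (p t)) → countBelow m p ≡ m
countBelow-all zero    all = refl
countBelow-all (suc m) {p} all with p 0 | all 0
... | true | _ = cong suc (countBelow-all m (all ∘ suc))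

countBelow-none : ∀ m {p} → (∀ t → ¬ T (p t)) → countBelow m p ≡ 0
countBelow-none zero    none = refl
countBelow-none (suc m) {p} none with p 0 | none 0
... | true  | ¬T = ⊥-elim (¬T tt)
... | false | _  = countBelow-none m (none ∘ suc)

countBelow-< : ∀ {c m} → c ≤ m → countBelow m (_<ᵇ c) ≡ c
countBelow-< {zero}  {m}     _         = countBelow-none m (λ _ ())
countBelow-< {suc c} {suc m} (s≤s c≤m) = cong suc (countBelow-< c≤m)

countBelow-> : ∀ c r → countBelow (suc c + r) (c <ᵇ_) ≡ r
countBelow-> zero    r = countBelow-all r (λ _ → tt)
countBelow-> (suc c) r = countBelow-> c r

-- Thresholds along a path

countBelow-double : ∀ m (f : ℕ → Bool) →
  countBelow (suc m) (λ t → f (t + t)) ≡ fromBool (f 0) + countBelow m (λ t → f (suc (suc (t + t))))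
countBelow-double m f = cong (fromBool (f 0) +_) (countBelow-cong m (λ t → cong (λ s → f (suc s)) (+-suc t t)))

below-above-balance₀ : ∀ m S → S < m + m →
  countBelow m (λ t → t + t <ᵇ S) + m ≡ countBelow m (λ t → S <ᵇ t + t) + suc S
below-above-balance₀ (suc m) S S<2m
  rewrite countBelow-double m (_<ᵇ S) | countBelow-double m (S <ᵇ_) = peeled S S<2m
  where
  peeled : ∀ S → S < suc m + suc m →
    fromBool (0 <ᵇ S) + countBelow m (λ t → suc (suc (t + t)) <ᵇ S) + suc m
      ≡ fromBool (S <ᵇ 0) + countBelow m (λ t → S <ᵇ suc (suc (t + t))) + suc S
  peeled zero _
    rewrite countBelow-none m {λ t → suc (suc (t + t)) <ᵇ 0} (λ _ ())
          | countBelow-all m {λ t → 0 <ᵇ suc (suc (t + t))} (λ _ → tt) = +-comm 1 m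
  peeled (suc zero) _
    rewrite countBelow-none m {λ t → suc (suc (t + t)) <ᵇ 1} (λ _ ())
          | countBelow-all m {λ t → 1 <ᵇ suc (suc (t + t))} (λ _ → tt) = +-comm 2 m
  peeled (suc (suc S)) S<2m = begin
    suc (countBelow m (λ t → t + t <ᵇ S) + suc m)       ≡⟨ cong suc (+-suc _ m) ⟩
    suc (suc (countBelow m (λ t → t + t <ᵇ S) + m))     ≡⟨ cong (suc ∘ suc) (below-above-balance₀ m S S<2m′) ⟩
    suc (suc (countBelow m (λ t → S <ᵇ t + t) + suc S)) ≡⟨ cong suc (sym (+-suc _ (suc S))) ⟩
    suc (countBelow m (λ t → S <ᵇ t + t) + suc (suc S)) ≡⟨ sym (+-suc _ (suc (suc S))) ⟩
    countBelow m (λ t → S <ᵇ t + t) + suc (suc (suc S)) ∎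
    where
    open ≡-Reasoning
    S<2m′ : S < m + m
    S<2m′ = ≤-pred (≤-pred (subst (suc (suc (suc S)) ≤_) (cong suc (+-suc m m)) S<2m))

below-above-balance : ∀ m α S → α ≤ S → S < α + (m + m) →
  countBelow m (λ t → α + (t + t) <ᵇ S) + (α + m) ≡ countBelow m (λ t → S <ᵇ α + (t + t)) + suc S
below-above-balance m α S α≤S S<α+2m with m≤n⇒∃[o]m+o≡n α≤S
... | δ , refl = begin
  A + (α + m)       ≡⟨ cong (_+ (α + m)) (countBelow-cong m (λ t → +-<ᵇ-cancelˡ α (t + t) δ)) ⟩
  A₀ + (α + m)      ≡⟨ x∙yz≈xz∙y A₀ α m ⟩
  (A₀ + m) + α      ≡⟨ cong (_+ α) (below-above-balance₀ m δ (+-cancelˡ-< α δ (m + m) S<α+2m)) ⟩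
  (B₀ + suc δ) + α  ≡⟨ regroup B₀ δ α ⟩
  B₀ + suc (α + δ)  ≡⟨ cong (_+ suc (α + δ)) (countBelow-cong m (λ t → sym (+-<ᵇ-cancelˡ α δ (t + t)))) ⟩
  B + suc (α + δ)   ∎
  where
  open ≡-Reasoning
  A  = countBelow m (λ t → α + (t + t) <ᵇ α + δ)
  B  = countBelow m (λ t → α + δ <ᵇ α + (t + t))
  A₀ = countBelow m (λ t → t + t <ᵇ δ)
  B₀ = countBelow m (λ t → δ <ᵇ t + t)
  regroup : ∀ b δ α → (b + suc δ) + α ≡ b + suc (α + δ)
  regroup = solve-∀

below-above-tie : ∀ m α S {x y} → α ≤ S → S < α + (m + m) →
  countBelow m (λ t → α + (t + t) <ᵇ S) + x ≡ countBelow m (λ t → S <ᵇ α + (t + t)) + y →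
  x + suc S ≡ y + (α + m)
below-above-tie m α S {x} {y} α≤S S<α+2m A+x≡B+y = +-cancelˡ-≡ B _ _ (begin
  B + (x + suc S)   ≡⟨ x∙yz≈xz∙y B x (suc S) ⟩
  (B + suc S) + x   ≡⟨ cong (_+ x) (sym (below-above-balance m α S α≤S S<α+2m)) ⟩
  (A + (α + m)) + x ≡⟨ xy∙z≈xz∙y A (α + m) x ⟩
  (A + x) + (α + m) ≡⟨ cong (_+ (α + m)) A+x≡B+y ⟩
  (B + y) + (α + m) ≡⟨ +-assoc B y (α + m) ⟩
  B + (y + (α + m)) ∎)
  where
  open ≡-Reasoning
  A = countBelow m (λ t → α + (t + t) <ᵇ S)
  B = countBelow m (λ t → S <ᵇ α + (t + t))

-- Sums over ordered pairs and the upper bound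

∑1+nC2≡[1+n]C2 : ∀ n → ∑[ i < n ] 1 + n C 2 ≡ suc n C 2
∑1+nC2≡[1+n]C2 n = trans (cong (_+ n C 2) (trans (countBelow-all n (λ _ → tt)) (sym (nC1≡n n))))
                        (nCk+nC[k+1]≡[n+1]C[k+1] n 1)

∑∑-peel : ∀ n (f : Fin (suc n) → Fin (suc n) → ℕ) →
  ∑[ v < suc n ] ∑[ u < suc n ] f v u
    ≡ f Fin.zero Fin.zero + (∑[ u < n ] (f Fin.zero (Fin.suc u) + f (Fin.suc u) Fin.zero)
                           + ∑[ v < n ] ∑[ u < n ] f (Fin.suc v) (Fin.suc u))
∑∑-peel n f = begin
  (f₀₀ + X) + ∑[ v < n ] (f (Fin.suc v) Fin.zero + ∑[ u < n ] f (Fin.suc v) (Fin.suc u))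
    ≡⟨ cong ((f₀₀ + X) +_) (∑-distrib-+ (λ v → f (Fin.suc v) Fin.zero) _) ⟩
  (f₀₀ + X) + (Y + Z)   ≡⟨ assoc₄ f₀₀ X Y Z ⟩
  f₀₀ + ((X + Y) + Z)   ≡⟨ cong (λ s → f₀₀ + (s + Z)) (sym (∑-distrib-+ (λ u → f Fin.zero (Fin.suc u)) _)) ⟩
  f₀₀ + (∑[ u < n ] (f Fin.zero (Fin.suc u) + f (Fin.suc u) Fin.zero) + Z) ∎
  where
  open ≡-Reasoning
  f₀₀ = f Fin.zero Fin.zero
  X = ∑[ u < n ] f Fin.zero (Fin.suc u)
  Y = ∑[ v < n ] f (Fin.suc v) Fin.zero
  Z = ∑[ v < n ] ∑[ u < n ] f (Fin.suc v) (Fin.suc u)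
  assoc₄ : ∀ a b c d → (a + b) + (c + d) ≡ a + ((b + c) + d)
  assoc₄ = solve-∀

fromBool-pair≤1 : ∀ {a b} → (T a → ¬ T b) → fromBool a + fromBool b ≤ 1
fromBool-pair≤1 {false} {b}     _   = fromBool≤1 b
fromBool-pair≤1 {true}  {false} _   = s≤s z≤n
fromBool-pair≤1 {true}  {true}  a⇒¬b = contradiction tt (a⇒¬b tt)

fromBool-pair≡1 : ∀ {a b} → (T a → ¬ T b) → T a ⊎ T b → fromBool a + fromBool b ≡ 1
fromBool-pair≡1 {true}  {false} _    _        = refl
fromBool-pair≡1 {false} {true}  _    _        = refl
fromBool-pair≡1 {true}  {true}  a⇒¬b _        = contradiction tt (a⇒¬b tt)
fromBool-pair≡1 {false} {false} _    (inj₁ ())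
fromBool-pair≡1 {false} {false} _    (inj₂ ())

∑∑-peel-asym : ∀ n (R : Fin (suc n) → Fin (suc n) → Bool) → (∀ u v → T (R u v) → ¬ T (R v u)) →
  ∑[ v < suc n ] ∑[ u < suc n ] fromBool (R v u)
    ≡ ∑[ u < n ] (fromBool (R Fin.zero (Fin.suc u)) + fromBool (R (Fin.suc u) Fin.zero))
      + ∑[ v < n ] ∑[ u < n ] fromBool (R (Fin.suc v) (Fin.suc u))
∑∑-peel-asym n R asym =
  trans (∑∑-peel n (λ v u → fromBool (R v u))) (cong (_+ (Pairs + Rest)) (fromBool-false (λ r → asym _ _ r r)))
  where
  Pairs = ∑[ u < n ] (fromBool (R Fin.zero (Fin.suc u)) + fromBool (R (Fin.suc u) Fin.zero))
  Rest  = ∑[ v < n ] ∑[ u < n ] fromBool (R (Fin.suc v) (Fin.suc u))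

∑∑-asym≤C2 : ∀ n (R : Fin n → Fin n → Bool) → (∀ u v → T (R u v) → ¬ T (R v u)) →
  ∑[ v < n ] ∑[ u < n ] fromBool (R v u) ≤ n C 2
∑∑-asym≤C2 zero    R asym = z≤n
∑∑-asym≤C2 (suc n) R asym = begin
  ∑[ v < suc n ] ∑[ u < suc n ] fromBool (R v u) ≡⟨ ∑∑-peel-asym n R asym ⟩
  Pairs + Rest                                   ≤⟨ +-mono-≤ (∑-mono-≤ n (λ u → fromBool-pair≤1 (asym _ _)))
                                                             (∑∑-asym≤C2 n _ (λ u v → asym _ _)) ⟩
  ∑[ u < n ] 1 + n C 2                           ≡⟨ ∑1+nC2≡[1+n]C2 n ⟩
  suc n C 2                                      ∎
  where
  open ≤-Reasoning
  Pairs = ∑[ u < n ] (fromBool (R Fin.zero (Fin.suc u)) + fromBool (R (Fin.suc u) Fin.zero))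
  Rest  = ∑[ v < n ] ∑[ u < n ] fromBool (R (Fin.suc v) (Fin.suc u))

∑∑-asym-connex≡C2 : ∀ n (R : Fin n → Fin n → Bool) → (∀ u v → T (R u v) → ¬ T (R v u)) →
  (∀ u v → u ≢ v → T (R u v) ⊎ T (R v u)) → ∑[ v < n ] ∑[ u < n ] fromBool (R v u) ≡ n C 2
∑∑-asym-connex≡C2 zero    R asym connex = refl
∑∑-asym-connex≡C2 (suc n) R asym connex = begin
  ∑[ v < suc n ] ∑[ u < suc n ] fromBool (R v u) ≡⟨ ∑∑-peel-asym n R asym ⟩
  Pairs + Rest                                   ≡⟨ cong₂ _+_
                                                        (sum-cong-≗ {n} (λ u → fromBool-pair≡1 (asym _ _) (connex _ _ (λ ()))))
                                                              (∑∑-asym-connex≡C2 n _ (λ u v → asym _ _)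
                                                                 (λ u v u≢v → connex _ _ (u≢v ∘ Finₚ.suc-injective))) ⟩
  ∑[ u < n ] 1 + n C 2                           ≡⟨ ∑1+nC2≡[1+n]C2 n ⟩
  suc n C 2                                      ∎
  where
  open ≡-Reasoning
  Pairs = ∑[ u < n ] (fromBool (R Fin.zero (Fin.suc u)) + fromBool (R (Fin.suc u) Fin.zero))
  Rest  = ∑[ v < n ] ∑[ u < n ] fromBool (R (Fin.suc v) (Fin.suc u))

module _ {n} (G : Graph n) where

  periG≡∑∑ : periG G ≡ ∑[ v < n ] ∑[ u < n ] fromBool (nG G v u <ᵇ nG G u v)
  periG≡∑∑ = trans (sumˡ-map-tabulate (peri G) (λ v → v))
                   (sum-cong-≗ {n} (λ v → count≡∑ {n} (λ u → nG G v u <ᵇ nG G u v)))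

  periG≤nC2 : periG G ≤ n C 2
  periG≤nC2 = subst (_≤ n C 2) (sym periG≡∑∑) (∑∑-asym≤C2 n _ (λ u v → <ᵇ-asym (nG G u v) (nG G v u)))

  periG≡nC2 : (∀ u v → u ≢ v → nG G u v ≢ nG G v u) → periG G ≡ n C 2
  periG≡nC2 no-ties = trans periG≡∑∑
    (∑∑-asym-connex≡C2 n _ (λ u v → <ᵇ-asym (nG G u v) (nG G v u)) (λ u v u≢v → <ᵇ-connex (no-ties u v u≢v)))

-- Graphs realising a metric

module MetricGraph {n : ℕ} (D : Fin n → Fin n → ℕ)
  (D-sym      : ∀ u v → D u v ≡ D v u)
  (D-refl     : ∀ u → D u u ≡ 0)
  (D≡0⇒≡      : ∀ {u v} → D u v ≡ 0 → u ≡ v)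
  (D-triangle : ∀ u w v → D u v ≤ D u w + D w v)
  (D-geodesic : ∀ u v {k} → D u v ≡ suc k → ∃[ w ] D u w ≡ k × D w v ≡ 1)
  (D-bounded  : ∀ u v → D u v ≤ n)
  where

  graph : Graph n
  graph = record
    { adj     = λ u v → D u v ≡ᵇ 1
    ; adj-sym = λ u v → cong (_≡ᵇ 1) (D-sym u v)
    ; irrefl  = λ u → cong (_≡ᵇ 1) (D-refl u)
    }

  within-sound : ∀ k u v → T (within graph k u v) → D u v ≤ k
  within-sound zero u v u≡v with toWitness u≡v
  ... | refl = ≤-reflexive (D-refl u)
  within-sound (suc k) u v w with Equivalence.to T-∨ w
  ... | inj₁ w′ = m≤n⇒m≤1+n (within-sound k u v w′)
  ... | inj₂ step with satisfied (any⁻ _ (allFin n) step)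
  ...   | x , x-step with Equivalence.to T-∧ x-step
  ...     | wx , xv = begin
    D u v         ≤⟨ D-triangle u x v ⟩
    D u x + D x v ≤⟨ +-mono-≤ (within-sound k u x wx) (≤-reflexive (≡ᵇ⇒≡ (D x v) 1 xv)) ⟩
    k + 1         ≡⟨ +-comm k 1 ⟩
    suc k         ∎
    where open ≤-Reasoning

  within-complete : ∀ k u v → D u v ≤ k → T (within graph k u v)
  within-complete zero u v D≤0 = fromWitness (D≡0⇒≡ (n≤0⇒n≡0 D≤0))
  within-complete (suc k) u v D≤1+k with m≤n⇒m<n∨m≡n D≤1+k
  ... | inj₁ D≤k = Equivalence.from T-∨ (inj₁ (within-complete k u v (≤-pred D≤k)))
  ... | inj₂ D≡1+k with D-geodesic u v D≡1+k
  ...   | x , ux≡k , xv≡1 = Equivalence.from T-∨ (inj₂ (any⁺ _ (lose (∈-allFin x)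
            (Equivalence.from T-∧ (within-complete k u x (≤-reflexive ux≡k) , ≡⇒≡ᵇ (D x v) 1 xv≡1)))))

  not-within≡<D : ∀ k u v → not (within graph k u v) ≡ (k <ᵇ D u v)
  not-within≡<D k u v = T-ext
    (λ ¬w → <⇒<ᵇ (≰⇒> (T-not⁻ ¬w ∘ within-complete k u v)))
    (λ k<D → T-not (<⇒≱ (<ᵇ⇒< k (D u v) k<D) ∘ within-sound k u v))

  dist≡D : ∀ u v → dist graph u v ≡ D u v
  dist≡D u v = begin
    dist graph u v
      ≡⟨ cong (λ ks → length (filter (λ k → not (within graph k u v) ≟ᵇ true) ks))
              (applyUpTo≡tabulate (λ k → k) n) ⟩
    length (filter (λ k → not (within graph k u v) ≟ᵇ true) (tabulate {n = n} toℕ))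
      ≡⟨ length-filter-tabulate {n = n} (λ k → not (within graph k u v)) toℕ ⟩
    countBelow n (λ k → not (within graph k u v))
      ≡⟨ countBelow-cong n (λ k → not-within≡<D k u v) ⟩
    countBelow n (_<ᵇ D u v)
      ≡⟨ countBelow-< (D-bounded u v) ⟩
    D u v ∎
    where open ≡-Reasoning

  connected : Connected graph
  connected u v = Equivalence.to T-≡ (within-complete n u v (D-bounded u v))

-- Acyclicity from a rank function

module _ {V : Set} where

  lastOf : V → List V → V
  lastOf x []       = x
  lastOf x (y ∷ ys) = lastOf y ys

  lastOf-∈ : ∀ x xs → lastOf x xs ∈ x ∷ xs
  lastOf-∈ x []       = here refl
  lastOf-∈ x (y ∷ ys) = there (lastOf-∈ y ys)

  Linked-last : ∀ {R : V → V → Set} x xs z → Linked R (x ∷ xs ++ z ∷ []) → R (lastOf x xs) z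
  Linked-last x []       z (r ∷ _) = r
  Linked-last x (y ∷ ys) z (_ ∷ l) = Linked-last y ys z l

  NonBacktracking : List V → Set
  NonBacktracking (x ∷ y ∷ z ∷ xs) = x ≢ z × NonBacktracking (y ∷ z ∷ xs)
  NonBacktracking _                = ⊤

  unique⇒nonBacktracking-snoc : ∀ x y ys z → AllPairs _≢_ (x ∷ y ∷ ys) → All (_≢ z) (x ∷ y ∷ ys) →
    NonBacktracking (x ∷ y ∷ ys ++ z ∷ [])
  unique⇒nonBacktracking-snoc x y []       z _                     (x≢z ∷ _) = x≢z , _
  unique⇒nonBacktracking-snoc x y (w ∷ ws) z ((_ ∷ x≢w ∷ _) ∷ unique) (_ ∷ ≢z) =
    x≢w , unique⇒nonBacktracking-snoc y w ws z unique ≢z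

  walk-no-return : ∀ {_≺_ : V → V → Set} → (∀ {a b c} → a ≺ b → b ≺ c → a ≺ c) → (∀ {a} → ¬ a ≺ a) →
    ∀ {x y ys} → Linked _≺_ (x ∷ y ∷ ys) → x ∈ y ∷ ys → ⊥
  walk-no-return ≺-trans ≺-irrefl (x≺y ∷ l) x∈ = ≺-irrefl (All.lookup (Linked⇒All ≺-trans x≺y l) x∈)

  secondOf : List V → V → V
  secondOf []      z = z
  secondOf (w ∷ _) _ = w

  Linked-second : ∀ {R : V → V → Set} {y} ys z → Linked R (y ∷ ys ++ z ∷ []) → R y (secondOf ys z)
  Linked-second []      z (r ∷ _) = r
  Linked-second (w ∷ _) z (r ∷ _) = r

  NonBacktracking-head : ∀ {x y} ys z → NonBacktracking (x ∷ y ∷ ys ++ z ∷ []) → x ≢ secondOf ys z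
  NonBacktracking-head []      z (x≢z , _) = x≢z
  NonBacktracking-head (w ∷ _) z (x≢w , _) = x≢w

  NonBacktracking-tail : ∀ {x xs} → NonBacktracking (x ∷ xs) → NonBacktracking xs
  NonBacktracking-tail {xs = []}             _        = _
  NonBacktracking-tail {xs = _ ∷ []}         _        = _
  NonBacktracking-tail {xs = _ ∷ _ ∷ _}      (_ , nb) = nb

-- Along a non-backtracking walk the rank never goes down right after going up, since the top
-- vertex would have two lower neighbours. Read from its start s, a cycle must therefore step
-- down first and step up into s last, so its second and its last vertex are two distinct
-- lower neighbours of s.
module Acyclicity {n} (G : Graph n) (rank : Fin n → ℕ)
  (adj-rank     : ∀ {u v} → adj G u v ≡ true → rank v ≡ suc (rank u) ⊎ rank u ≡ suc (rank v))
  (lower-unique : ∀ {v p q} → adj G v p ≡ true → adj G v q ≡ true →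
                  rank v ≡ suc (rank p) → rank v ≡ suc (rank q) → p ≡ q)
  where

  Adj Up Down : Fin n → Fin n → Set
  Adj u v  = adj G u v ≡ true
  Up u v   = rank v ≡ suc (rank u)
  Down u v = rank u ≡ suc (rank v)

  peak⇒backtrack : ∀ {x y z} → Adj x y → Adj y z → Up x y → Down y z → x ≡ z
  peak⇒backtrack {x} {y} xy yz up down = lower-unique (trans (adj-sym G y x) xy) yz up down

  ascends : ∀ x y ys → Linked Adj (x ∷ y ∷ ys) → NonBacktracking (x ∷ y ∷ ys) → Up x y → Linked Up (x ∷ y ∷ ys)
  ascends x y []       _               _          up = up ∷ [-]
  ascends x y (z ∷ zs) (xy ∷ yz ∷ adjs) (x≢z , nb) up with adj-rank yz
  ... | inj₁ up′  = up ∷ ascends y z zs (yz ∷ adjs) nb up′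
  ... | inj₂ down = contradiction (peak⇒backtrack xy yz up down) x≢z

  descends-or-ends-up : ∀ x xs z → Linked Adj (x ∷ xs ++ z ∷ []) → NonBacktracking (x ∷ xs ++ z ∷ []) →
    Linked Down (x ∷ xs ++ z ∷ []) ⊎ Up (lastOf x xs) z
  descends-or-ends-up x []       z (xz ∷ [-]) _ with adj-rank xz
  ... | inj₁ up   = inj₂ up
  ... | inj₂ down = inj₁ (down ∷ [-])
  descends-or-ends-up x (y ∷ ys) z (xy ∷ adjs) nb
    with descends-or-ends-up y ys z adjs (NonBacktracking-tail nb) | adj-rank xy
  ... | inj₂ ends-up | _         = inj₂ ends-up
  ... | inj₁ downs   | inj₂ down = inj₁ (down ∷ downs)
  ... | inj₁ downs   | inj₁ up   =
    contradiction (peak⇒backtrack xy (Linked-second ys z adjs) up (Linked-second ys z downs)) (NonBacktracking-head ys z nb)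

  no-cycle : ∀ s rest → 2 ≤ length rest → AllPairs _≢_ (s ∷ rest) → Linked Adj (s ∷ rest ++ s ∷ []) → ⊥
  no-cycle s (_ ∷ [])       (s≤s ()) _ _
  no-cycle s (x₁ ∷ x₂ ∷ xs) _ (s∉ ∷ x₁∉ ∷ unique) walk = first-step (adj-rank (Linked.head walk))
    where
    nb : NonBacktracking (s ∷ x₁ ∷ x₂ ∷ xs ++ s ∷ [])
    nb = All.lookup s∉ (there (here refl)) ,
         unique⇒nonBacktracking-snoc x₁ x₂ xs s (x₁∉ ∷ unique) (All.map (_∘ sym) s∉)
    returns : s ∈ x₁ ∷ x₂ ∷ xs ++ s ∷ []
    returns = ∈-++⁺ʳ (x₁ ∷ x₂ ∷ xs) (here refl)
    last-step : Down s x₁ → Linked Down (s ∷ x₁ ∷ x₂ ∷ xs ++ s ∷ []) ⊎ Up (lastOf x₂ xs) s → ⊥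
    last-step down (inj₁ downs)   =
      walk-no-return (λ ab bc → <-trans bc ab) (<-irrefl refl) (Linked.map (λ d → ≤-reflexive (sym d)) downs) returns
    last-step down (inj₂ ends-up) = All.lookup x₁∉ (lastOf-∈ x₂ xs)
      (lower-unique (Linked.head walk) (trans (adj-sym G s _) (Linked-last s (x₁ ∷ x₂ ∷ xs) s walk)) down ends-up)
    first-step : Up s x₁ ⊎ Down s x₁ → ⊥
    first-step (inj₁ up)   =
      walk-no-return <-trans (<-irrefl refl) (Linked.map (λ u → ≤-reflexive (sym u)) (ascends s x₁ _ walk nb up)) returns
    first-step (inj₂ down) = last-step down (descends-or-ends-up s (x₁ ∷ x₂ ∷ xs) s walk nb)

  acyclic : Acyclic G
  acyclic c = no-cycle start rest long distinct closed
    where open Cycle c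

∣n-1+n∣≡1 : ∀ n → ∣ n - suc n ∣ ≡ 1
∣n-1+n∣≡1 zero    = refl
∣n-1+n∣≡1 (suc n) = ∣n-1+n∣≡1 n

∣1+n-n∣≡1 : ∀ n → ∣ suc n - n ∣ ≡ 1
∣1+n-n∣≡1 n = trans (∣-∣-comm (suc n) n) (∣n-1+n∣≡1 n)

∣m-n∣≡1⇒ : ∀ m n → ∣ m - n ∣ ≡ 1 → n ≡ suc m ⊎ m ≡ suc n
∣m-n∣≡1⇒ zero    (suc zero) _  = inj₁ refl
∣m-n∣≡1⇒ (suc zero) zero    _  = inj₂ refl
∣m-n∣≡1⇒ (suc m) (suc n) eq with ∣m-n∣≡1⇒ m n eq
... | inj₁ n≡1+m = inj₁ (cong suc n≡1+m)
... | inj₂ m≡1+n = inj₂ (cong suc m≡1+n)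

∣m-1+n∣≡1+∣m-n∣ : ∀ {m n} → m ≤ n → ∣ m - suc n ∣ ≡ suc ∣ m - n ∣
∣m-1+n∣≡1+∣m-n∣ {zero}  {n}     z≤n       = refl
∣m-1+n∣≡1+∣m-n∣ {suc m} {suc n} (s≤s m≤n) = ∣m-1+n∣≡1+∣m-n∣ m≤n

∣m-n∣≡1+∣m-1+n∣ : ∀ {m n} → n < m → ∣ m - n ∣ ≡ suc ∣ m - suc n ∣
∣m-n∣≡1+∣m-1+n∣ {suc m} {zero}  _         = cong suc (sym (∣-∣-identityʳ m))
∣m-n∣≡1+∣m-1+n∣ {suc m} {suc n} (s≤s n<m) = ∣m-n∣≡1+∣m-1+n∣ n<m

∣-∣< : ∀ {m n b} → m < b → n < b → ∣ m - n ∣ < b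
∣-∣< {m} {n} m<b n<b = ≤-<-trans (∣m-n∣≤m⊔n m n) (⊔-pres-<m m<b n<b)

line-step : ∀ {m n b k} → m < b → n < b → ∣ m - n ∣ ≡ suc k →
  ∃[ n′ ] n′ < b × ∣ m - n′ ∣ ≡ k × ∣ n′ - n ∣ ≡ 1
line-step {m} {n} m<b n<b mn≡1+k with <-cmp m n
... | tri≈ _ refl _ = contradiction (trans (sym (∣n-n∣≡0 m)) mn≡1+k) λ ()
line-step {m} {suc n} m<b n<b mn≡1+k | tri< m<1+n _ _ =
  n , <-trans (n<1+n n) n<b , suc-injective (trans (sym (∣m-1+n∣≡1+∣m-n∣ (≤-pred m<1+n))) mn≡1+k) , ∣n-1+n∣≡1 n
... | tri> _ _ n<m =
  suc n , ≤-<-trans n<m m<b , suc-injective (trans (sym (∣m-n∣≡1+∣m-1+n∣ n<m)) mn≡1+k) , ∣1+n-n∣≡1 n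

∣m+n-m∣≡n : ∀ m n → ∣ m + n - m ∣ ≡ n
∣m+n-m∣≡n m n = trans (∣-∣-comm (m + n) m) (∣m-m+n∣≡n m n)

SameOrder : ℕ → ℕ → ℕ → ℕ → Set
SameOrder L R P Q = (L <ᵇ R) ≡ (P <ᵇ Q) × (R <ᵇ L) ≡ (Q <ᵇ P)

<ᵇ-cong-+ : ∀ {L R P Q} → L + Q ≡ R + P → (L <ᵇ R) ≡ (P <ᵇ Q)
<ᵇ-cong-+ {L} {R} {P} {Q} eq = <ᵇ-cong
  (λ L<R → +-cancelˡ-< R P Q (subst (_< R + Q) eq (+-monoˡ-< Q L<R)))
  (λ P<Q → +-cancelʳ-< Q L R (subst (_< R + Q) (sym eq) (+-monoʳ-< R P<Q)))

same-order-+ : ∀ {L R P Q} → L + Q ≡ R + P → SameOrder L R P Q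
same-order-+ {L} {R} {P} {Q} eq = <ᵇ-cong-+ {L} {R} {P} {Q} eq , <ᵇ-cong-+ {R} {L} {Q} {P} (sym eq)

same-order-< : ∀ {L R P Q} → L < R → P < Q → SameOrder L R P Q
same-order-< L<R P<Q = trans (<ᵇ-true L<R) (sym (<ᵇ-true P<Q)) , trans (<ᵇ-false (<⇒≤ L<R)) (sym (<ᵇ-false (<⇒≤ P<Q)))

same-order-> : ∀ {L R P Q} → R < L → Q < P → SameOrder L R P Q
same-order-> R<L Q<P = swap (same-order-< R<L Q<P)

-- α and β are lengths hung below x and y; if they differ by less than y - x, a point t of the
-- line is nearer to (x, α) exactly when α + 2t < β + x + y.
bisector : ∀ α β {x y} t → x ≤ y → x + α < y + β → x + β < y + α →
  SameOrder (α + ∣ t - x ∣) (β + ∣ t - y ∣) (α + (t + t)) (β + (x + y))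
bisector α β {x} {y} t x≤y h₁ h₂ with ≤-total t x
... | inj₁ t≤x with m≤n⇒∃[o]m+o≡n t≤x | m≤n⇒∃[o]m+o≡n (≤-trans t≤x x≤y)
...   | p , refl | q , refl
  rewrite ∣m-m+n∣≡n t p | ∣m-m+n∣≡n t q = same-order-< L<R (begin-strict
    α + (t + t)              ≤⟨ +-monoˡ-≤ (t + t) (m≤m+n α p) ⟩
    (α + p) + (t + t)        <⟨ +-monoˡ-< (t + t) L<R ⟩
    (β + q) + (t + t)        ≤⟨ m≤m+n ((β + q) + (t + t)) p ⟩
    (β + q) + (t + t) + p    ≡⟨ regroup β q t p ⟩
    β + ((t + p) + (t + q))  ∎)
  where
  open ≤-Reasoning
  L<R : α + p < β + q
  L<R = subst₂ _<_ (+-comm p α) (+-comm q β)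
          (+-cancelˡ-< t (p + α) (q + β) (subst₂ _<_ (+-assoc t p α) (+-assoc t q β) h₁))
  regroup : ∀ β q t p → (β + q) + (t + t) + p ≡ β + ((t + p) + (t + q))
  regroup = solve-∀
bisector α β {x} {y} t x≤y h₁ h₂ | inj₂ x≤t with ≤-total t y
... | inj₁ t≤y with m≤n⇒∃[o]m+o≡n x≤t | m≤n⇒∃[o]m+o≡n t≤y
...   | p , refl | q , refl
  rewrite ∣m+n-m∣≡n x p | ∣m-m+n∣≡n (x + p) q = same-order-+ {α + p} {β + q} (balance-identity α β x p q)
  where
  balance-identity : ∀ α β x p q → (α + p) + (β + (x + ((x + p) + q))) ≡ (β + q) + (α + ((x + p) + (x + p)))
  balance-identity = solve-∀
bisector α β {x} {y} t x≤y h₁ h₂ | inj₂ x≤t | inj₂ y≤t with m≤n⇒∃[o]m+o≡n x≤y | m≤n⇒∃[o]m+o≡n y≤t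
...   | r , refl | q , refl
  rewrite ∣m+n-m∣≡n (x + r) q | +-assoc x r q | ∣m+n-m∣≡n x (r + q) = same-order-> R<L (begin-strict
    β + (x + (x + r))             <⟨ +-monoˡ-< (x + (x + r)) β<r+α ⟩
    (r + α) + (x + (x + r))       ≡⟨ regroup r α x ⟩
    α + ((x + r) + (x + r))       ≤⟨ +-monoʳ-≤ α (+-mono-≤ (m≤m+n (x + r) q) (m≤m+n (x + r) q)) ⟩
    α + ((x + r + q) + (x + r + q)) ≡⟨ cong (λ s → α + (s + s)) (+-assoc x r q) ⟩
    α + ((x + (r + q)) + (x + (r + q))) ∎)
  where
  open ≤-Reasoning
  β<r+α : β < r + α
  β<r+α = +-cancelˡ-< x β (r + α) (subst (x + β <_) (+-assoc x r α) h₂)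
  regroup : ∀ r α x → (r + α) + (x + (x + r)) ≡ α + ((x + r) + (x + r))
  regroup = solve-∀
  regroup′ : ∀ r α q → (r + α) + q ≡ α + (r + q)
  regroup′ = solve-∀
  R<L : β + q < α + (r + q)
  R<L = subst (β + q <_) (regroup′ r α q) (+-monoˡ-< q β<r+α)

∣m-n∣≤k : ∀ {m n k} → m ≤ n + k → n ≤ m + k → ∣ m - n ∣ ≤ k
∣m-n∣≤k {m} {n} {k} m≤n+k n≤m+k with ∣m-n∣≡[m∸n]∨[n∸m] m n
... | inj₁ eq = subst (_≤ k) (sym eq) (m≤n+o⇒m∸n≤o m n m≤n+k)
... | inj₂ eq = subst (_≤ k) (sym eq) (m≤n+o⇒m∸n≤o n m n≤m+k)

∣m-1+m+n∣≡1+n : ∀ m n → ∣ m - suc m + n ∣ ≡ suc n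
∣m-1+m+n∣≡1+n m n = trans (∣m-1+n∣≡1+∣m-n∣ (m≤m+n m n)) (cong suc (∣m-m+n∣≡n m n))

beyond-left : ∀ {j c t} k → j ≤ c → c ≤ j + suc k → t < c → ∣ t - j ∣ < suc k + ∣ t - c ∣
beyond-left {j} {c} {t} k j≤c c≤j+k t<c with m≤n⇒∃[o]m+o≡n t<c
... | s , refl rewrite ∣m-1+m+n∣≡1+n t s with ≤-total t j
...   | inj₁ t≤j with m≤n⇒∃[o]m+o≡n t≤j
...     | r , refl rewrite ∣m-m+n∣≡n t r =
  ≤-<-trans (+-cancelˡ-≤ t r (suc s) (subst (t + r ≤_) (sym (+-suc t s)) j≤c)) (m<n+m (suc s) (s≤s z≤n))
beyond-left {j} {c} {t} k j≤c c≤j+k t<c | s , refl | inj₂ j≤t with m≤n⇒∃[o]m+o≡n j≤t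
...     | r , refl rewrite ∣m+n-m∣≡n j r =
  <-≤-trans (s≤s (m+n≤o⇒m≤o r (≤-pred 1+r+s≤1+k))) (m≤m+n (suc k) (suc s))
  where
  regroup : ∀ j r s → suc (j + r + s) ≡ j + suc (r + s)
  regroup = solve-∀
  1+r+s≤1+k : suc (r + s) ≤ suc k
  1+r+s≤1+k = +-cancelˡ-≤ j _ _ (subst (_≤ j + suc k) (regroup j r s) c≤j+k)

beyond-right : ∀ {j c t} k → c ≤ j → j ≤ c + suc k → c < t → ∣ t - j ∣ < suc k + ∣ t - c ∣
beyond-right {j} {c} {t} k c≤j j≤c+k c<t with ≤-total j t
... | inj₁ j≤t with m≤n⇒∃[o]m+o≡n c≤j | m≤n⇒∃[o]m+o≡n j≤t
...   | r , refl | u , refl rewrite ∣m+n-m∣≡n (c + r) u | +-assoc c r u | ∣m+n-m∣≡n c (r + u) =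
  ≤-<-trans (m≤n+m u r) (m<n+m (r + u) {suc k} (s≤s z≤n))
beyond-right {j} {c} {t} k c≤j j≤c+k c<t | inj₂ t≤j with m≤n⇒∃[o]m+o≡n c<t | m≤n⇒∃[o]m+o≡n t≤j
...   | s , refl | u , refl rewrite ∣m-m+n∣≡n (suc c + s) u | ∣-∣-comm (suc c + s) c | ∣m-1+m+n∣≡1+n c s =
  <-≤-trans (s≤s (m+n≤o⇒n≤o s (≤-pred 1+s+u≤1+k))) (m≤m+n (suc k) (suc s))
  where
  regroup : ∀ c s u → suc c + s + u ≡ c + suc (s + u)
  regroup = solve-∀
  1+s+u≤1+k : suc (s + u) ≤ suc k
  1+s+u≤1+k = +-cancelˡ-≤ c _ _ (subst (_≤ c + suc k) (regroup c s u) j≤c+k)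

∣m-n∣≤1+m : ∀ m {n} → n ≤ 1 → ∣ m - n ∣ ≤ suc m
∣m-n∣≤1+m m {n} n≤1 = begin
  ∣ m - n ∣ ≤⟨ ∣m-n∣≤m⊔n m n ⟩
  m ⊔ n     ≤⟨ m⊔n≤m+n m n ⟩
  m + n     ≤⟨ +-monoʳ-≤ m n≤1 ⟩
  m + 1     ≡⟨ +-comm m 1 ⟩
  suc m     ∎
  where
  open ≤-Reasoning

-- The spider

-- leg d is the vertex at distance d + 1 from path c, for the c of the spider at hand.
data Site : Set where
  path : ℕ → Site
  leg  : ℕ → Site

index : Site → ℕ
index (path i) = i
index (leg d)  = d

taxicab : ℕ × ℕ → ℕ × ℕ → ℕ
taxicab (x , y) (x′ , y′) = ∣ x - x′ ∣ + ∣ y - y′ ∣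

taxicab-sym : ∀ p q → taxicab p q ≡ taxicab q p
taxicab-sym (x , y) (x′ , y′) = cong₂ _+_ (∣-∣-comm x x′) (∣-∣-comm y y′)

taxicab-triangle : ∀ p q r → taxicab p r ≤ taxicab p q + taxicab q r
taxicab-triangle (x , y) (x′ , y′) (x″ , y″) = begin
  ∣ x - x″ ∣ + ∣ y - y″ ∣
    ≤⟨ +-mono-≤ (∣-∣-triangle x x′ x″) (∣-∣-triangle y y′ y″) ⟩
  (∣ x - x′ ∣ + ∣ x′ - x″ ∣) + (∣ y - y′ ∣ + ∣ y′ - y″ ∣)
    ≡⟨ interchange ∣ x - x′ ∣ ∣ x′ - x″ ∣ ∣ y - y′ ∣ ∣ y′ - y″ ∣ ⟩
  (∣ x - x′ ∣ + ∣ y - y′ ∣) + (∣ x′ - x″ ∣ + ∣ y′ - y″ ∣) ∎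
  where open ≤-Reasoning

taxicab≡0⇒≡ : ∀ p q → taxicab p q ≡ 0 → p ≡ q
taxicab≡0⇒≡ (x , y) (x′ , y′) eq =
  cong₂ _,_ (∣m-n∣≡0⇒m≡n (m+n≡0⇒m≡0 _ eq)) (∣m-n∣≡0⇒m≡n (m+n≡0⇒n≡0 ∣ x - x′ ∣ eq))

module SpiderMetric (c : ℕ) where

  D : Site → Site → ℕ
  D (path i) (path j) = ∣ i - j ∣
  D (path i) (leg e)  = suc e + ∣ i - c ∣
  D (leg d)  (path j) = suc d + ∣ c - j ∣
  D (leg d)  (leg e)  = ∣ d - e ∣

  -- The spider embeds isometrically in the taxicab plane: the path along the x-axis, the leg
  -- vertically above (c, 0). This gives the metric axioms at once.
  point : Site → ℕ × ℕ
  point (path i) = i , 0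
  point (leg d)  = c , suc d

  D≡taxicab : ∀ s t → D s t ≡ taxicab (point s) (point t)
  D≡taxicab (path i) (path j) = sym (+-identityʳ ∣ i - j ∣)
  D≡taxicab (path i) (leg e)  = +-comm (suc e) ∣ i - c ∣
  D≡taxicab (leg d)  (path j) = +-comm (suc d) ∣ c - j ∣
  D≡taxicab (leg d)  (leg e)  = cong (_+ ∣ d - e ∣) (sym (∣n-n∣≡0 c))

  point-injective : ∀ s t → point s ≡ point t → s ≡ t
  point-injective (path i) (path j) refl = refl
  point-injective (leg d)  (leg e)  refl = refl

  D-sym : ∀ s t → D s t ≡ D t s
  D-sym s t = trans (D≡taxicab s t) (trans (taxicab-sym (point s) (point t)) (sym (D≡taxicab t s)))

  D-refl : ∀ s → D s s ≡ 0
  D-refl (path i) = ∣n-n∣≡0 i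
  D-refl (leg d)  = ∣n-n∣≡0 d

  D≡0⇒≡ : ∀ {s t} → D s t ≡ 0 → s ≡ t
  D≡0⇒≡ {s} {t} eq = point-injective s t (taxicab≡0⇒≡ (point s) (point t) (trans (sym (D≡taxicab s t)) eq))

  D-triangle : ∀ s r t → D s t ≤ D s r + D r t
  D-triangle s r t = begin
    D s t                                  ≡⟨ D≡taxicab s t ⟩
    taxicab (point s) (point t)            ≤⟨ taxicab-triangle (point s) (point r) (point t) ⟩
    taxicab (point s) (point r) + taxicab (point r) (point t) ≡⟨ sym (cong₂ _+_ (D≡taxicab s r) (D≡taxicab r t)) ⟩
    D s r + D r t                          ∎
    where open ≤-Reasoning

  height : Site → ℕ
  height = D (path 0)

  path-leg-adjacent : ∀ {i e} → suc e + ∣ i - c ∣ ≡ 1 → e ≡ 0 × i ≡ c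
  path-leg-adjacent {i} {e} eq = m+n≡0⇒m≡0 e (suc-injective eq) , ∣m-n∣≡0⇒m≡n (m+n≡0⇒n≡0 e (suc-injective eq))

  leg-path-adjacent : ∀ {d j} → suc d + ∣ c - j ∣ ≡ 1 → d ≡ 0 × j ≡ c
  leg-path-adjacent {d} {j} eq with path-leg-adjacent {j} {d} (trans (cong (suc d +_) (∣-∣-comm j c)) eq)
  ... | d≡0 , j≡c = d≡0 , j≡c

  adjacent-height : ∀ s t → D s t ≡ 1 → height t ≡ suc (height s) ⊎ height s ≡ suc (height t)
  adjacent-height (path i) (path j) eq = ∣m-n∣≡1⇒ i j eq
  adjacent-height (path i) (leg e)  eq with path-leg-adjacent {i} {e} eq
  ... | refl , refl = inj₁ refl
  adjacent-height (leg d)  (path j) eq with leg-path-adjacent {d} {j} eq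
  ... | refl , refl = inj₂ refl
  adjacent-height (leg d)  (leg e)  eq with ∣m-n∣≡1⇒ d e eq
  ... | inj₁ refl = inj₁ refl
  ... | inj₂ refl = inj₂ refl

  path-and-leg-not-both-lower : ∀ v i e → D v (path i) ≡ 1 → D v (leg e) ≡ 1 →
    height v ≡ suc i → height v ≡ suc (suc e + c) → ⊥
  path-and-leg-not-both-lower (path j) i e _  ve _ h≡ with path-leg-adjacent {j} {e} ve
  ... | refl , refl = m≢1+n+m c h≡
  path-and-leg-not-both-lower (leg d)  i e vi _ h≡ h≡′ with leg-path-adjacent {d} {i} vi
  ... | refl , refl = m≢1+n+m c (suc-injective (trans (sym h≡) h≡′))

  lower-neighbour-unique : ∀ v p q → D v p ≡ 1 → D v q ≡ 1 →
    height v ≡ suc (height p) → height v ≡ suc (height q) → p ≡ q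
  lower-neighbour-unique v (path i) (path j) _  _  hp hq = cong path (suc-injective (trans (sym hp) hq))
  lower-neighbour-unique v (leg d)  (leg e)  _  _  hp hq =
    cong leg (suc-injective (+-cancelʳ-≡ c _ _ (suc-injective (trans (sym hp) hq))))
  lower-neighbour-unique v (path i) (leg e)  vp vq hp hq = ⊥-elim (path-and-leg-not-both-lower v i e vp vq hp hq)
  lower-neighbour-unique v (leg d)  (path j) vp vq hp hq = ⊥-elim (path-and-leg-not-both-lower v j d vq vp hq hp)

module Spider (c a : ℕ) where
  open SpiderMetric c public

  m : ℕ
  m = suc c + suc c

  c<m : c < m
  c<m = s≤s (m≤m+n c (suc c))

  Valid : Site → Set
  Valid (path i) = i < m
  Valid (leg d)  = d < a

  geodesic-step : ∀ s t {k} → Valid s → Valid t → D s t ≡ suc k → ∃[ w ] Valid w × D s w ≡ k × D w t ≡ 1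
  geodesic-step (path i) (path j) vs vt eq with line-step vs vt eq
  ... | j′ , vj′ , d≡k , d≡1 = path j′ , vj′ , d≡k , d≡1
  geodesic-step (leg d) (leg e) vs vt eq with line-step vs vt eq
  ... | e′ , ve′ , d≡k , d≡1 = leg e′ , ve′ , d≡k , d≡1
  geodesic-step (path i) (leg zero) vs vt eq =
    path c , c<m , suc-injective eq , cong suc (∣n-n∣≡0 c)
  geodesic-step (path i) (leg (suc e)) vs vt eq =
    leg e , <-trans (n<1+n e) vt , suc-injective eq , ∣n-1+n∣≡1 e
  geodesic-step (leg d) (path j) {k} vs vt eq with ∣ c - j ∣ in cj
  ... | zero  = leg 0 , ≤-<-trans z≤n vs , trans (∣-∣-identityʳ d) (trans (sym (+-identityʳ d)) (suc-injective eq)) ,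
                cong suc cj
  ... | suc g with line-step c<m vt cj
  ...   | j′ , vj′ , cj′≡g , j′j≡1 =
    path j′ , vj′ , trans (cong (suc d +_) cj′≡g) (trans (sym (+-suc d g)) (suc-injective eq)) , j′j≡1

  D-bounded : ∀ s t → Valid s → Valid t → D s t ≤ m + a
  D-bounded (path i) (path j) vs vt = ≤-trans (<⇒≤ (∣-∣< vs vt)) (m≤m+n m a)
  D-bounded (path i) (leg e)  vs vt = ≤-trans (+-mono-≤ vt (<⇒≤ (∣-∣< vs c<m))) (≤-reflexive (+-comm a m))
  D-bounded (leg d)  (path j) vs vt = ≤-trans (+-mono-≤ vs (<⇒≤ (∣-∣< c<m vt))) (≤-reflexive (+-comm a m))
  D-bounded (leg d)  (leg e)  vs vt = ≤-trans (<⇒≤ (∣-∣< vs vt)) (m≤n+m a m)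

module SpiderGraph (c a : ℕ) where
  open Spider c a public

  site : Fin (m + a) → Site
  site x = [ path ∘ toℕ , leg ∘ toℕ ]′ (splitAt m x)

  site-valid : ∀ x → Valid (site x)
  site-valid x with splitAt m x
  ... | inj₁ i = toℕ<n i
  ... | inj₂ d = toℕ<n d

  site-injective : ∀ x y → site x ≡ site y → x ≡ y
  site-injective x y eq = begin
    x                       ≡⟨ sym (join-splitAt m a x) ⟩
    join m a (splitAt m x)  ≡⟨ cong (join m a) (split-injective (splitAt m x) (splitAt m y) eq) ⟩
    join m a (splitAt m y)  ≡⟨ join-splitAt m a y ⟩
    y                       ∎
    where
    open ≡-Reasoning
    split-injective : ∀ p q → [ path ∘ toℕ , leg ∘ toℕ ]′ p ≡ [ path ∘ toℕ , leg ∘ toℕ ]′ q → p ≡ q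
    split-injective (inj₁ i) (inj₁ j) eq = cong inj₁ (toℕ-injective (cong index eq))
    split-injective (inj₂ d) (inj₂ e) eq = cong inj₂ (toℕ-injective (cong index eq))
    split-injective (inj₁ i) (inj₂ e) ()
    split-injective (inj₂ d) (inj₁ j) ()

  site-surjective : ∀ s → Valid s → ∃[ x ] site x ≡ s
  site-surjective (path i) i<m = join m a (inj₁ (fromℕ< i<m)) ,
    trans (cong [ path ∘ toℕ , leg ∘ toℕ ]′ (splitAt-join m a (inj₁ (fromℕ< i<m)))) (cong path (toℕ-fromℕ< i<m))
  site-surjective (leg d)  d<a = join m a (inj₂ (fromℕ< d<a)) ,
    trans (cong [ path ∘ toℕ , leg ∘ toℕ ]′ (splitAt-join m a (inj₂ (fromℕ< d<a)))) (cong leg (toℕ-fromℕ< d<a))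

  Dᶠ : Fin (m + a) → Fin (m + a) → ℕ
  Dᶠ x y = D (site x) (site y)

  geodesicᶠ : ∀ u v {k} → Dᶠ u v ≡ suc k → ∃[ w ] Dᶠ u w ≡ k × Dᶠ w v ≡ 1
  geodesicᶠ u v eq with geodesic-step (site u) (site v) (site-valid u) (site-valid v) eq
  ... | s , vs , us≡k , sv≡1 with site-surjective s vs
  ...   | w , refl = w , us≡k , sv≡1

  open MetricGraph Dᶠ (λ u v → D-sym (site u) (site v)) (D-refl ∘ site) (site-injective _ _ ∘ D≡0⇒≡)
    (λ u w v → D-triangle (site u) (site w) (site v)) geodesicᶠ
    (λ u v → D-bounded (site u) (site v) (site-valid u) (site-valid v))
    public renaming (graph to spider)

  adjacent⇒D≡1 : ∀ {u v} → adj spider u v ≡ true → Dᶠ u v ≡ 1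
  adjacent⇒D≡1 {u} {v} uv = ≡ᵇ⇒≡ (Dᶠ u v) 1 (Equivalence.from T-≡ uv)

  open Acyclicity spider (height ∘ site)
    (λ {u} {v} uv → adjacent-height (site u) (site v) (adjacent⇒D≡1 {u} {v} uv))
    (λ {v} {p} {q} vp vq hp hq → site-injective p q
       (lower-neighbour-unique (site v) (site p) (site q) (adjacent⇒D≡1 {v} {p} vp) (adjacent⇒D≡1 {v} {q} vq) hp hq))
    using (acyclic)

  spider-isTree : IsTree spider
  spider-isTree = connected , acyclic

module SpiderCounts (c a : ℕ) where
  open SpiderGraph c a public

  closer : Site → Site → Site → Bool
  closer w s t = D w s <ᵇ D w t

  pathCount legCount closerCount : Site → Site → ℕ
  pathCount s t   = countBelow m (λ i → closer (path i) s t)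
  legCount s t    = countBelow a (λ d → closer (leg d) s t)
  closerCount s t = pathCount s t + legCount s t

  nG-spider : ∀ u v → nG spider u v ≡ closerCount (site u) (site v)
  nG-spider u v = begin
    nG spider u v
      ≡⟨ count≡∑ (λ w → dist spider w u <ᵇ dist spider w v) ⟩
    ∑[ w < m + a ] fromBool (dist spider w u <ᵇ dist spider w v)
      ≡⟨ sum-cong-≗ {m + a} (λ w → cong fromBool (cong₂ _<ᵇ_ (dist≡D w u) (dist≡D w v))) ⟩
    ∑[ w < m + a ] fromBool (closer (site w) (site u) (site v))
      ≡⟨ ∑-splitAt m (λ p → fromBool (closer ([ path ∘ toℕ , leg ∘ toℕ ]′ p) (site u) (site v))) ⟩
    closerCount (site u) (site v) ∎
    where open ≡-Reasoning

-- No two vertices of the spider tie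

module NoTies (c a : ℕ) (3≤c : 3 ≤ c) (1≤a : 1 ≤ a) (a≤2 : a ≤ 2) where
  open SpiderCounts c a

  m≡2+2c : m ≡ suc (suc (c + c))
  m≡2+2c = cong suc (+-suc c c)

  c+c<m : c + c < m
  c+c<m = subst (c + c <_) (sym m≡2+2c) (≤-trans (n<1+n (c + c)) (n≤1+n _))

  path-pair-imbalance : ∀ S → Tri (c + c < S) (c + c ≡ S) (S < c + c) →
    countBelow a (λ _ → c + c <ᵇ S) + suc S ≢ countBelow a (λ _ → S <ᵇ c + c) + m
  path-pair-imbalance S (tri< 2c<S _ _) eq = <⇒≢ (begin-strict
    m                 ≡⟨ m≡2+2c ⟩
    suc (suc (c + c)) ≤⟨ s≤s 2c<S ⟩
    suc S             <⟨ m<n+m (suc S) 1≤a ⟩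
    a + suc S         ∎) (sym (trans (cong (_+ suc S) (sym (countBelow-all a (λ _ → <⇒<ᵇ 2c<S))))
                              (trans eq (cong (_+ m) (countBelow-none a (λ _ → <ᵇ-asym (c + c) S (<⇒<ᵇ 2c<S)))))))
    where open ≤-Reasoning
  path-pair-imbalance S (tri≈ ¬2c<S 2c≡S ¬S<2c) eq = <⇒≢ (n<1+n (suc S)) (begin
    suc S             ≡⟨ cong (_+ suc S) (sym (countBelow-none a (λ _ → ¬2c<S ∘ <ᵇ⇒< (c + c) S))) ⟩
    countBelow a (λ _ → c + c <ᵇ S) + suc S ≡⟨ eq ⟩
    countBelow a (λ _ → S <ᵇ c + c) + m     ≡⟨ cong (_+ m) (countBelow-none a (λ _ → ¬S<2c ∘ <ᵇ⇒< S (c + c))) ⟩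
    m                 ≡⟨ m≡2+2c ⟩
    suc (suc (c + c)) ≡⟨ cong (suc ∘ suc) 2c≡S ⟩
    suc (suc S)       ∎)
    where open ≡-Reasoning
  path-pair-imbalance S (tri> _ _ S<2c) eq = <⇒≢ (begin-strict
    suc S             ≤⟨ S<2c ⟩
    c + c             <⟨ c+c<m ⟩
    m                 ≤⟨ m≤n+m m a ⟩
    a + m             ∎) (trans (cong (_+ suc S) (sym (countBelow-none a (λ _ → <ᵇ-asym S (c + c) (<⇒<ᵇ S<2c)))))
                          (trans eq (cong (_+ m) (countBelow-all a (λ _ → <⇒<ᵇ S<2c)))))
    where open ≤-Reasoning

  a<m : a < m
  a<m = s≤s (≤-trans a≤2 (≤-trans (≤-trans (n≤1+n 2) 3≤c) (m≤m+n c (suc c))))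

  no-tie-path-path : ∀ {i j} → i < j → j < m → closerCount (path i) (path j) ≢ closerCount (path j) (path i)
  no-tie-path-path {i} {j} i<j j<m tie = path-pair-imbalance S (<-cmp (c + c) S) leg-balance
    where
    S = i + j
    i+0<j+0 = +-monoˡ-< 0 i<j
    order : ∀ t → SameOrder ∣ t - i ∣ ∣ t - j ∣ (t + t) S
    order t = bisector 0 0 t (<⇒≤ i<j) i+0<j+0 i+0<j+0
    legs-agree : ∀ s → (suc s + ∣ c - i ∣ <ᵇ suc s + ∣ c - j ∣) ≡ (c + c <ᵇ S)
    legs-agree s = trans (+-<ᵇ-cancelˡ (suc s) _ _) (proj₁ (order c))
    legs-agree′ : ∀ s → (suc s + ∣ c - j ∣ <ᵇ suc s + ∣ c - i ∣) ≡ (S <ᵇ c + c)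
    legs-agree′ s = trans (+-<ᵇ-cancelˡ (suc s) _ _) (proj₂ (order c))
    x = countBelow a (λ _ → c + c <ᵇ S)
    y = countBelow a (λ _ → S <ᵇ c + c)
    leg-balance : x + suc S ≡ y + m
    leg-balance = below-above-tie m 0 S z≤n (+-mono-< (<-trans i<j j<m) j<m) (begin
      countBelow m (λ t → t + t <ᵇ S) + x
        ≡⟨ sym (cong₂ _+_ (countBelow-cong m (proj₁ ∘ order)) (countBelow-cong a legs-agree)) ⟩
      closerCount (path i) (path j) ≡⟨ tie ⟩
      closerCount (path j) (path i)
        ≡⟨ cong₂ _+_ (countBelow-cong m (proj₂ ∘ order)) (countBelow-cong a legs-agree′) ⟩
      countBelow m (λ t → S <ᵇ t + t) + y ∎)
      where open ≡-Reasoning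
  legs-prefer-leg : ∀ {d j} → d ≤ 1 → j ≢ c → legCount (leg d) (path j) ≡ a
  legs-prefer-leg {d} {j} d≤1 j≢c =
    countBelow-all a (λ e → <⇒<ᵇ (≤-<-trans (∣m-n∣≤1+m e d≤1) (m<m+n (suc e) 0<∣c-j∣)))
    where
    0<∣c-j∣ : 0 < ∣ c - j ∣
    0<∣c-j∣ = n≢0⇒n>0 (j≢c ∘ sym ∘ ∣m-n∣≡0⇒m≡n)

  legs-reject-path : ∀ {d j} → d ≤ 1 → legCount (path j) (leg d) ≡ 0
  legs-reject-path {d} {j} d≤1 =
    countBelow-none a (λ e e-closer →
      <⇒≱ (<ᵇ⇒< _ _ e-closer) (≤-trans (∣m-n∣≤1+m e d≤1) (m≤m+n (suc e) ∣ c - j ∣)))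

  no-tie-far-right : ∀ {d j} → d ≤ 1 → c + suc d < j → j < m →
    closerCount (leg d) (path j) ≢ closerCount (path j) (leg d)
  no-tie-far-right {d} {j} d≤1 far j<m tie = <⇒≢ leg-side-larger (sym path-balance)
    where
    c<j = ≤-trans (s≤s (m≤m+n c (suc d))) far
    order : ∀ t → SameOrder (suc d + ∣ t - c ∣) ∣ t - j ∣ (suc d + (t + t)) (c + j)
    order t = bisector (suc d) 0 t (<⇒≤ c<j) (subst (c + suc d <_) (sym (+-identityʳ j)) far)
                (subst (_< j + suc d) (sym (+-identityʳ c)) (<-≤-trans c<j (m≤m+n j (suc d))))
    path-balance : a + suc (c + j) ≡ 0 + (suc d + m)
    path-balance = below-above-tie m (suc d) (c + j) (≤-trans (≤-trans (m≤n+m (suc d) c) (<⇒≤ far)) (m≤n+m j c))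
      (<-≤-trans (+-mono-< (<-trans c<j j<m) j<m) (m≤n+m (m + m) (suc d))) (begin
        countBelow m (λ t → suc d + (t + t) <ᵇ c + j) + a
          ≡⟨ sym (cong₂ _+_ (countBelow-cong m (proj₁ ∘ order)) (legs-prefer-leg d≤1 (<⇒≢ c<j ∘ sym))) ⟩
        closerCount (leg d) (path j) ≡⟨ tie ⟩
        closerCount (path j) (leg d)
          ≡⟨ cong₂ _+_ (countBelow-cong m (proj₂ ∘ order)) (legs-reject-path d≤1) ⟩
        countBelow m (λ t → c + j <ᵇ suc d + (t + t)) + 0 ∎)
      where open ≡-Reasoning
    regroup : ∀ c d → suc d + suc (suc (c + c)) ≡ suc (c + suc (c + suc d))
    regroup = solve-∀
    leg-side-larger : suc d + m < a + suc (c + j)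
    leg-side-larger = begin-strict
      suc d + m                       ≡⟨ trans (cong (suc d +_) m≡2+2c) (regroup c d) ⟩
      suc (c + suc (c + suc d))       <⟨ s≤s (s≤s (+-monoʳ-≤ c far)) ⟩
      1 + suc (c + j)                 ≤⟨ +-monoˡ-≤ (suc (c + j)) 1≤a ⟩
      a + suc (c + j)                 ∎
      where open ≤-Reasoning

  no-tie-far-left : ∀ {d j} → d ≤ 1 → j + suc d < c →
    closerCount (leg d) (path j) ≢ closerCount (path j) (leg d)
  no-tie-far-left {d} {j} d≤1 far tie = <⇒≢ path-side-smaller path-balance
    where
    S = suc d + (j + c)
    j<c = ≤-<-trans (m≤m+n j (suc d)) far
    order : ∀ t → SameOrder ∣ t - j ∣ (suc d + ∣ t - c ∣) (t + t) S
    order t = bisector 0 (suc d) t (<⇒≤ j<c) (subst (_< c + suc d) (sym (+-identityʳ j)) (<-≤-trans j<c (m≤m+n c (suc d))))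
                (subst (j + suc d <_) (sym (+-identityʳ c)) far)
    S+1≤2c : suc S ≤ c + c
    S+1≤2c = subst (_≤ c + c) (regroup d j c) (+-monoˡ-≤ c far)
      where
      regroup : ∀ d j c → suc (j + suc d) + c ≡ suc (suc d + (j + c))
      regroup = solve-∀
    path-balance : 0 + suc S ≡ a + (0 + m)
    path-balance = below-above-tie m 0 S z≤n (<-≤-trans S+1≤2c (+-mono-≤ (<⇒≤ c<m) (<⇒≤ c<m))) (begin
        countBelow m (λ t → t + t <ᵇ S) + 0
          ≡⟨ sym (cong₂ _+_ (countBelow-cong m (proj₁ ∘ order)) (legs-reject-path d≤1)) ⟩
        closerCount (path j) (leg d) ≡⟨ sym tie ⟩
        closerCount (leg d) (path j)
          ≡⟨ cong₂ _+_ (countBelow-cong m (proj₂ ∘ order)) (legs-prefer-leg d≤1 (<⇒≢ j<c)) ⟩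
        countBelow m (λ t → S <ᵇ t + t) + a ∎)
      where open ≡-Reasoning
    path-side-smaller : suc S < a + m
    path-side-smaller = <-≤-trans (≤-<-trans S+1≤2c c+c<m) (m≤n+m m a)

  -- No path vertex prefers the leg vertex, while at least c path vertices prefer path j.
  no-tie-near : ∀ {d j} → d ≤ 1 → j ≤ c + suc d → c ≤ j + suc d →
    closerCount (leg d) (path j) ≢ closerCount (path j) (leg d)
  no-tie-near {d} {j} d≤1 j≤c+k c≤j+k tie = <⇒≱ (<-≤-trans (s≤s a≤2) 3≤c) (begin
    c                                  ≤⟨ path-side-large (≤-total j c) ⟩
    pathCount (path j) (leg d)         ≤⟨ m≤m+n _ _ ⟩
    closerCount (path j) (leg d)       ≡⟨ sym tie ⟩
    pathCount (leg d) (path j) + legCount (leg d) (path j)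
                                       ≡⟨ cong (_+ legCount (leg d) (path j)) path-never-prefers-leg ⟩
    legCount (leg d) (path j)          ≤⟨ countBelow≤ a (λ f → closer (leg f) (leg d) (path j)) ⟩
    a                                  ∎)
    where
    open ≤-Reasoning
    path-never-prefers-leg : pathCount (leg d) (path j) ≡ 0
    path-never-prefers-leg = countBelow-none m (λ t t-closer → <⇒≱ (<ᵇ⇒< _ _ t-closer) (begin
      ∣ t - j ∣             ≤⟨ ∣-∣-triangle t c j ⟩
      ∣ t - c ∣ + ∣ c - j ∣ ≤⟨ +-monoʳ-≤ ∣ t - c ∣ (∣m-n∣≤k c≤j+k j≤c+k) ⟩
      ∣ t - c ∣ + suc d     ≡⟨ +-comm ∣ t - c ∣ (suc d) ⟩
      suc d + ∣ t - c ∣     ∎))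
    path-side-large : j ≤ c ⊎ c ≤ j → c ≤ pathCount (path j) (leg d)
    path-side-large (inj₁ j≤c) = begin
      c                          ≡⟨ sym (countBelow-< (<⇒≤ c<m)) ⟩
      countBelow m (_<ᵇ c)       ≤⟨ countBelow-mono m (λ t t<c → <⇒<ᵇ (beyond-left d j≤c c≤j+k (<ᵇ⇒< t c t<c))) ⟩
      pathCount (path j) (leg d) ∎
    path-side-large (inj₂ c≤j) = begin
      c                          ≤⟨ n≤1+n c ⟩
      suc c                      ≡⟨ sym (countBelow-> c (suc c)) ⟩
      countBelow m (c <ᵇ_)       ≤⟨ countBelow-mono m (λ t c<t → <⇒<ᵇ (beyond-right d c≤j j≤c+k (<ᵇ⇒< c t c<t))) ⟩
      pathCount (path j) (leg d) ∎

  no-tie-leg-path : ∀ {d j} → d < a → j < m → closerCount (leg d) (path j) ≢ closerCount (path j) (leg d)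
  no-tie-leg-path {d} {j} d<a j<m with c + suc d <? j | j + suc d <? c
  ... | yes far | _       = no-tie-far-right d≤1 far j<m
    where d≤1 = ≤-pred (≤-trans d<a a≤2)
  ... | no _    | yes far = no-tie-far-left d≤1 far
    where d≤1 = ≤-pred (≤-trans d<a a≤2)
  ... | no ¬far | no ¬far′ = no-tie-near d≤1 (≮⇒≥ ¬far) (≮⇒≥ ¬far′)
    where d≤1 = ≤-pred (≤-trans d<a a≤2)

  no-tie-leg-leg : ∀ {d e} → d < e → closerCount (leg d) (leg e) ≢ closerCount (leg e) (leg d)
  no-tie-leg-leg {d} {e} d<e tie = <⇒≱ a<m (begin
    m                                 ≡⟨ sym (countBelow-all m (λ t → <⇒<ᵇ (d-closer t))) ⟩
    pathCount (leg d) (leg e)         ≤⟨ m≤m+n _ _ ⟩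
    closerCount (leg d) (leg e)       ≡⟨ tie ⟩
    pathCount (leg e) (leg d) + legCount (leg e) (leg d)
      ≡⟨ cong (_+ legCount (leg e) (leg d)) (countBelow-none m (λ t e-closer → <-asym (<ᵇ⇒< _ _ e-closer) (d-closer t))) ⟩
    legCount (leg e) (leg d)          ≤⟨ countBelow≤ a (λ f → closer (leg f) (leg e) (leg d)) ⟩
    a                                 ∎)
    where
    open ≤-Reasoning
    d-closer : ∀ t → suc d + ∣ t - c ∣ < suc e + ∣ t - c ∣
    d-closer t = +-monoˡ-< ∣ t - c ∣ (s≤s d<e)

  no-ties : ∀ s t → Valid s → Valid t → s ≢ t → closerCount s t ≢ closerCount t s
  no-ties (path i) (path j) vs vt s≢t with <-cmp i j
  ... | tri< i<j _ _ = no-tie-path-path i<j vt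
  ... | tri≈ _ refl _ = contradiction refl s≢t
  ... | tri> _ _ j<i = no-tie-path-path j<i vs ∘ sym
  no-ties (leg d)  (path j) vs vt _   = no-tie-leg-path vs vt
  no-ties (path i) (leg e)  vs vt _   = no-tie-leg-path vt vs ∘ sym
  no-ties (leg d)  (leg e)  vs vt s≢t with <-cmp d e
  ... | tri< d<e _ _ = no-tie-leg-leg d<e
  ... | tri≈ _ refl _ = contradiction refl s≢t
  ... | tri> _ _ e<d = no-tie-leg-leg e<d ∘ sym

  spider-no-ties : ∀ u v → u ≢ v → nG spider u v ≢ nG spider v u
  spider-no-ties u v u≢v tie = no-ties (site u) (site v) (site-valid u) (site-valid v) (u≢v ∘ site-injective u v)
    (trans (sym (nG-spider u v)) (trans tie (nG-spider v u)))

TreeAttainingC2 : ℕ → Set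
TreeAttainingC2 n = Σ (Graph n) (λ T → IsTree T × periG T ≡ n C 2)

spider-attains-C2 : ∀ c a → 3 ≤ c → 1 ≤ a → a ≤ 2 → TreeAttainingC2 (suc c + suc c + a)
spider-attains-C2 c a 3≤c 1≤a a≤2 = spider , spider-isTree , periG≡nC2 spider spider-no-ties
  where
  open SpiderCounts c a
  open NoTies c a 3≤c 1≤a a≤2

-- n - 3 = 2c + (a - 1): the parity of n decides a ∈ {1, 2}, and c ≥ 3 as n ≥ 9.
tree-attaining-C2 : ∀ n → 9 ≤ n → TreeAttainingC2 n
tree-attaining-C2 n 9≤n = subst TreeAttainingC2 n≡ (spider-attains-C2 c (suc b) 3≤c (s≤s z≤n) (m%n<n s 2))
  where
  s = n ∸ 3
  c = s / 2
  b = s % 2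
  3≤c : 3 ≤ c
  3≤c = /-monoˡ-≤ 2 (∸-monoˡ-≤ 3 9≤n)
  regroup : ∀ b c → suc c + suc c + suc b ≡ 3 + (b + c * 2)
  regroup = solve-∀
  n≡ : suc c + suc c + suc b ≡ n
  n≡ = trans (regroup b c)
         (trans (cong (3 +_) (sym (m≡m%n+[m/n]*n s 2))) (m+[n∸m]≡n (≤-trans (s≤s (s≤s (s≤s z≤n))) 9≤n)))

mainTheorem15 : (n : ℕ) → 9 ≤ n →
    ((T : Graph n) → IsTree T → periG T ≤ n C 2)
    × Σ (Graph n) (λ T → IsTree T × periG T ≡ n C 2)
mainTheorem15 n 9≤n = (λ T _ → periG≤nC2 T) , tree-attaining-C2 n 9≤n
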